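{- For every positive integer $k$, the circular chromatic number of the signed projective cube satisfies $\chi_c(SPC(k))=4$.
   Context: A signed graph is a graph with a sign $+$ or $-$ on each edge (at most one edge of each sign between two vertices). The signed projective cube $SPC(k)$ is the signed graph with vertex set $\mathbb{Z}_2^k$ in which $x,y$ are joined by a positive edge iff $x-y\in\{e_1,\dots,e_k\}$ (the standard basis) and by a negative edge iff $x-y=J$ (the all-ones vector); $SPC(1)$ is a digon (a positive and a negative edge between two vertices). For a real $r>0$, a circular $r$-coloring of a signed graph $(G,\sigma)$ is a mapping $\phi$ from $V(G)$ to a circle $C$ of circumference $r$ such that for every negative edge $uv$ the distance along $C$ between $\phi(u)$ and $\phi(v)$ is at least $1$, and for every positive edge $xy$ the distance between $\phi(x)$ and $\phi(y)$ is at most $\frac{r}{2}-1$. The circular chromatic number $\chi_c(G,\sigma)$ is the smallest $r$ for which a circular $r$-coloring exists.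
   Formalization: The circumference r and the positions of the colours on the circle range over the rationals instead of the reals. -}

module Defs where

open import Data.Nat using (ℕ)
open import Data.Bool using (Bool; true; false; _xor_)
open import Data.Fin using (Fin)
import Data.Fin.Properties as FinP
open import Data.Vec using (Vec; zipWith; replicate; tabulate)
open import Data.Rational using (ℚ; 0ℚ; 1ℚ; ½; _+_; _-_; _*_; ∣_∣; _⊓_; _≤_; _<_)
open import Data.Product using (Σ; ∃; _×_)
open import Relation.Binary.PropositionalEquality using (_≡_)
open import Relation.Nullary using (¬_)
open import Relation.Nullary.Decidable using (⌊_⌋)

-- A signed graph: vertex set with symmetric-in-intent positive and negative
-- edge relations (at most one edge of each sign between two vertices).
record SignedGraph : Set₁ where
  field
    V   : Set
    Pos : V → V → Set
    Neg : V → V → Set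

open SignedGraph public

-- Z_2^k as Vec Bool k; subtraction in Z_2^k is coordinatewise xor.
_⊖_ : {k : ℕ} → Vec Bool k → Vec Bool k → Vec Bool k
x ⊖ y = zipWith _xor_ x y

basis : {k : ℕ} → Fin k → Vec Bool k
basis i = tabulate (λ j → ⌊ i FinP.≟ j ⌋)

allOnes : (k : ℕ) → Vec Bool k
allOnes k = replicate k true

SPC : ℕ → SignedGraph
SPC k = record
  { V   = Vec Bool k
  ; Pos = λ x y → ∃ λ (i : Fin k) → x ⊖ y ≡ basis i
  ; Neg = λ x y → x ⊖ y ≡ allOnes k
  }

-- Points of the circle of circumference r are represented by their
-- arc-length coordinate p with 0 ≤ p < r.  Distance along the circle:
circDist : ℚ → ℚ → ℚ → ℚ
circDist r p q = ∣ p - q ∣ ⊓ (r - ∣ p - q ∣)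

IsCircularColoring : (G : SignedGraph) → ℚ → (V G → ℚ) → Set
IsCircularColoring G r φ =
  (∀ v → (0ℚ ≤ φ v) × (φ v < r)) ×
  (∀ u v → Neg G u v → 1ℚ ≤ circDist r (φ u) (φ v)) ×
  (∀ x y → Pos G x y → circDist r (φ x) (φ y) ≤ (r * ½) - 1ℚ)

CircularColorable : SignedGraph → ℚ → Set
CircularColorable G r = Σ (V G → ℚ) (IsCircularColoring G r)

ChiCEquals : SignedGraph → ℚ → Set
ChiCEquals G c =
  CircularColorable G c ×
  (∀ r → 0ℚ < r → r < c → ¬ CircularColorable G r)

{-# OPTIONS --safe #-}
-- Lift a circular r-colouring φ of SPC(k) to the double cover Z₂^(k+1), putting the switched copy of x at
-- the antipode of φ x.  Adjacent vertices of the cover are then joined by arcs of signed length δ with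
-- |δ| ≤ d = r/2 - 1, and walking once along every generator e₁, …, e_k, J carries each vertex to its switched
-- copy.  If r < 4 then 4d < r, so the δ's sum to exactly 0 around every 4-cycle and along every edge walked
-- back and forth (the sum is ≡ 0 modulo r and shorter than r).  Hence the total W of δ along that walk is
-- ≡ r/2 modulo r, whereas the walk repeated twice uses every generator twice and gives 2W = 0.
-- For r = 4 colouring each vertex by its first coordinate works.
module Submission where

open import Defs
open import Data.Nat as ℕ using (ℕ; zero; suc; _≥_)
open import Data.Integer using (+_)
open import Data.Rational using (ℚ; _/_; 0ℚ; 1ℚ; ½; _+_; _-_; _*_; -_; ∣_∣; _⊓_; _≤_; _<_; _<?_)
import Data.Rational.Properties as QP
open import Data.Rational.Solver using (module +-*-Solver)
open +-*-Solver using (solve; _:=_; _:+_; _:-_; _:*_; :-_; con)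
open import Algebra.Properties.Monoid.Mult QP.+-0-monoid using (×-homo-+) renaming (_×_ to _·_)
open import Data.Bool using (Bool; true; false; _xor_)
open import Data.Bool.Properties using (xor-assoc; xor-comm; xor-same; xor-identityˡ; xor-identityʳ)
open import Data.Fin using (Fin; zero; suc; _≟_)
open import Data.Vec as Vec using (Vec; []; _∷_; replicate)
open import Data.Vec.Properties
  using (zipWith-assoc; zipWith-identityˡ; zipWith-identityʳ; tabulate-cong; tabulate-allFin; map-const)
open import Data.List using (List; []; _∷_; _++_; _∷ʳ_; map; foldl; allFin; tabulate)
open import Data.List.Properties using (foldl-map; foldl-∷ʳ; map-tabulate)
open import Data.Maybe using (Maybe; just; nothing)
open import Data.Product using (_×_; _,_; proj₁; proj₂)
open import Data.Sum using (_⊎_; inj₁; inj₂; [_,_]′)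
open import Data.Empty using (⊥; ⊥-elim)
open import Function using (_∘_; id)
open import Relation.Nullary using (¬_)
open import Relation.Nullary.Decidable using (⌊⌋-map′; from-yes)
open import Relation.Binary.Bundles using (Setoid)
import Relation.Binary.Reasoning.Setoid
open import Relation.Binary.PropositionalEquality

⊖-assoc : ∀ {n} (x y z : Vec Bool n) → (x ⊖ y) ⊖ z ≡ x ⊖ (y ⊖ z)
⊖-assoc = zipWith-assoc xor-assoc

⊖-comm : ∀ {n} (x y : Vec Bool n) → x ⊖ y ≡ y ⊖ x
⊖-comm []      []      = refl
⊖-comm (a ∷ x) (b ∷ y) = cong₂ _∷_ (xor-comm a b) (⊖-comm x y)

⊖-self : ∀ {n} (x : Vec Bool n) → x ⊖ x ≡ replicate n false
⊖-self []      = refl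
⊖-self (a ∷ x) = cong₂ _∷_ (xor-same a) (⊖-self x)

x⊖y⊖y≡x : ∀ {n} (x y : Vec Bool n) → (x ⊖ y) ⊖ y ≡ x
x⊖y⊖y≡x x y = begin
  (x ⊖ y) ⊖ y            ≡⟨ ⊖-assoc x y y ⟩
  x ⊖ (y ⊖ y)            ≡⟨ cong (x ⊖_) (⊖-self y) ⟩
  x ⊖ replicate _ false  ≡⟨ zipWith-identityʳ xor-identityʳ x ⟩
  x                      ∎
  where open ≡-Reasoning

x⊖[x⊖y]≡y : ∀ {n} (x y : Vec Bool n) → x ⊖ (x ⊖ y) ≡ y
x⊖[x⊖y]≡y x y = begin
  x ⊖ (x ⊖ y)            ≡⟨ ⊖-assoc x x y ⟨
  (x ⊖ x) ⊖ y            ≡⟨ cong (_⊖ y) (⊖-self x) ⟩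
  replicate _ false ⊖ y  ≡⟨ zipWith-identityˡ xor-identityˡ y ⟩
  y                      ∎
  where open ≡-Reasoning

x⊖y⊖z≡x⊖z⊖y : ∀ {n} (x y z : Vec Bool n) → (x ⊖ y) ⊖ z ≡ (x ⊖ z) ⊖ y
x⊖y⊖z≡x⊖z⊖y x y z = begin
  (x ⊖ y) ⊖ z  ≡⟨ ⊖-assoc x y z ⟩
  x ⊖ (y ⊖ z)  ≡⟨ cong (x ⊖_) (⊖-comm y z) ⟩
  x ⊖ (z ⊖ y)  ≡⟨ ⊖-assoc x z y ⟨
  (x ⊖ z) ⊖ y  ∎
  where open ≡-Reasoning

basis-suc : ∀ {n} (i : Fin n) → basis (suc i) ≡ false ∷ basis i
basis-suc i = cong (false ∷_) (tabulate-cong (λ j → ⌊⌋-map′ _ _ (i ≟ j)))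

x⊖basis-zero : ∀ {n} (b : Bool) (x : Vec Bool n) → (b ∷ x) ⊖ basis zero ≡ (b xor true) ∷ x
x⊖basis-zero {n} b x = cong ((b xor true) ∷_) (begin
  x ⊖ Vec.tabulate (λ _ → false)
    ≡⟨ cong (x ⊖_) (trans (tabulate-allFin _) (map-const (Vec.allFin n) false)) ⟩
  x ⊖ replicate n false           ≡⟨ zipWith-identityʳ xor-identityʳ x ⟩
  x                               ∎)
  where open ≡-Reasoning

x⊖basis-suc : ∀ {n} (b : Bool) (x : Vec Bool n) i → (b ∷ x) ⊖ basis (suc i) ≡ b ∷ (x ⊖ basis i)
x⊖basis-suc b x i =
  trans (cong ((b ∷ x) ⊖_) (basis-suc i)) (cong (_∷ (x ⊖ basis i)) (xor-identityʳ b))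

walk : ∀ {n} {A : Set} → (A → Vec Bool n) → Vec Bool n → List A → Vec Bool n
walk generator = foldl (λ σ a → σ ⊖ generator a)

walk-⊖ : ∀ {n} {A : Set} (generator : A → Vec Bool n) σ τ w →
         walk generator (σ ⊖ τ) w ≡ walk generator σ w ⊖ τ
walk-⊖ generator σ τ []      = refl
walk-⊖ generator σ τ (a ∷ w) = begin
  walk generator ((σ ⊖ τ) ⊖ generator a) w
    ≡⟨ cong (λ ρ → walk generator ρ w) (x⊖y⊖z≡x⊖z⊖y σ τ (generator a)) ⟩
  walk generator ((σ ⊖ generator a) ⊖ τ) w
    ≡⟨ walk-⊖ generator (σ ⊖ generator a) τ w ⟩
  walk generator (σ ⊖ generator a) w ⊖ τ    ∎
  where open ≡-Reasoning

walk-basis-suc : ∀ {n} (b : Bool) (x : Vec Bool n) l →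
                 walk (basis ∘ suc) (b ∷ x) l ≡ b ∷ walk basis x l
walk-basis-suc b x []      = refl
walk-basis-suc b x (i ∷ l) = trans (cong (λ σ → walk (basis ∘ suc) σ l) (x⊖basis-suc b x i))
                                   (walk-basis-suc b (x ⊖ basis i) l)

walk-allFin : ∀ {n} (x : Vec Bool n) → walk basis x (allFin n) ≡ x ⊖ allOnes n
walk-allFin []              = refl
walk-allFin {suc n} (b ∷ x) = begin
  walk basis ((b ∷ x) ⊖ basis zero) (tabulate suc)    ≡⟨ cong (λ σ → walk basis σ (tabulate suc)) (x⊖basis-zero b x) ⟩
  walk basis ((b xor true) ∷ x) (tabulate suc)        ≡⟨ cong (walk basis _) (map-tabulate id suc) ⟨
  walk basis ((b xor true) ∷ x) (map suc (allFin n))  ≡⟨ foldl-map _ suc _ (allFin n) ⟩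
  walk (basis ∘ suc) ((b xor true) ∷ x) (allFin n)    ≡⟨ walk-basis-suc (b xor true) x (allFin n) ⟩
  (b xor true) ∷ walk basis x (allFin n)              ≡⟨ cong ((b xor true) ∷_) (walk-allFin x) ⟩
  (b ∷ x) ⊖ allOnes (suc n)                           ∎
  where open ≡-Reasoning

p≤p+q : ∀ p {q} → 0ℚ ≤ q → p ≤ p + q
p≤p+q p {q} 0≤q = subst (_≤ p + q) (QP.+-identityʳ p) (QP.+-monoʳ-≤ p 0≤q)

p<p+q : ∀ p {q} → 0ℚ < q → p < p + q
p<p+q p {q} 0<q = subst (_< p + q) (QP.+-identityʳ p) (QP.+-monoʳ-< p 0<q)

p≤q⇒0≤q-p : ∀ {p q} → p ≤ q → 0ℚ ≤ q - p
p≤q⇒0≤q-p {p} {q} p≤q = subst (_≤ q - p) (QP.+-inverseʳ p) (QP.+-monoˡ-≤ (- p) p≤q)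

p<q⇒0<q-p : ∀ {p q} → p < q → 0ℚ < q - p
p<q⇒0<q-p {p} {q} p<q = subst (_< q - p) (QP.+-inverseʳ p) (QP.+-monoˡ-< (- p) p<q)

∣-∣-elim : ∀ (P : ℚ → Set) {p} → P p → P (- p) → P ∣ p ∣
∣-∣-elim P {p} Pp P-p =
  [ (λ ∣p∣≡p → subst P (sym ∣p∣≡p) Pp) , (λ ∣p∣≡-p → subst P (sym ∣p∣≡-p) P-p) ]′ (QP.∣p∣≡p∨∣p∣≡-p p)

∣p-q∣≡∣q-p∣ : ∀ p q → ∣ p - q ∣ ≡ ∣ q - p ∣
∣p-q∣≡∣q-p∣ p q =
  trans (sym (QP.∣-p∣≡∣p∣ (p - q))) (cong ∣_∣ (solve 2 (λ p q → :- (p :- q) := q :- p) refl p q))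

four : ℚ
four = + 4 / 1

module Circle (r : ℚ) (0<r : 0ℚ < r) where

  h : ℚ
  h = r * ½

  d : ℚ
  d = h - 1ℚ

  0<h : 0ℚ < h
  0<h = QP.*-monoˡ-<-pos ½ 0<r

  h+h≡r : h + h ≡ r
  h+h≡r = solve 1 (λ r → r :* con ½ :+ r :* con ½ := r) refl r

  0≤n·r : ∀ n → 0ℚ ≤ n · r
  0≤n·r zero    = QP.≤-refl
  0≤n·r (suc n) = QP.+-mono-≤ (QP.<⇒≤ 0<r) (0≤n·r n)

  record Multiple (z : ℚ) : Set where
    constructor multiple
    field
      m n : ℕ
      z≡m·r-n·r : z ≡ m · r - n · r

  multiple-r : Multiple r
  multiple-r = multiple 1 0 (solve 1 (λ r → r := (r :+ con 0ℚ) :- con 0ℚ) refl r)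

  multiple-+ : ∀ {x y} → Multiple x → Multiple y → Multiple (x + y)
  multiple-+ {x} {y} (multiple m n x≡) (multiple m′ n′ y≡) =
    multiple (m ℕ.+ m′) (n ℕ.+ n′) (begin
    x + y                                ≡⟨ cong₂ _+_ x≡ y≡ ⟩
    (m · r - n · r) + (m′ · r - n′ · r)  ≡⟨ solve 4 (λ a b c e → (a :- b) :+ (c :- e) := (a :+ c) :- (b :+ e))
                                                    refl (m · r) (n · r) (m′ · r) (n′ · r) ⟩
    (m · r + m′ · r) - (n · r + n′ · r)  ≡⟨ cong₂ _-_ (×-homo-+ r m m′) (×-homo-+ r n n′) ⟨
    (m ℕ.+ m′) · r - (n ℕ.+ n′) · r      ∎)
    where open ≡-Reasoning

  multiple-neg : ∀ {x} → Multiple x → Multiple (- x)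
  multiple-neg (multiple m n x≡) =
    multiple n m (trans (cong -_ x≡) (solve 2 (λ a b → :- (a :- b) := b :- a) refl (m · r) (n · r)))

  multiple-small⇒0 : ∀ {z} → Multiple z → ∣ z ∣ < r → z ≡ 0ℚ
  multiple-small⇒0 (multiple m n z≡) = go m n z≡
    where
    go : ∀ m n {z} → z ≡ m · r - n · r → ∣ z ∣ < r → z ≡ 0ℚ
    go zero    zero    z≡ _     = z≡
    go (suc m) (suc n) z≡       =
      go m n (trans z≡ (solve 3 (λ r a b → (r :+ a) :- (r :+ b) := a :- b) refl r (m · r) (n · r)))
    go (suc m) zero    {z} z≡ small = ⊥-elim (QP.<-irrefl refl (QP.≤-<-trans r≤∣z∣ small))
      where
      ∣z∣≡ : ∣ z ∣ ≡ suc m · r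
      ∣z∣≡ = trans (cong ∣_∣ (trans z≡ (QP.+-identityʳ _))) (QP.0≤p⇒∣p∣≡p (0≤n·r (suc m)))
      r≤∣z∣ : r ≤ ∣ z ∣
      r≤∣z∣ = subst (r ≤_) (sym ∣z∣≡) (p≤p+q r (0≤n·r m))
    go zero    (suc n) {z} z≡ small = QP.neg-injective (go (suc n) zero
      (trans (cong -_ z≡) (solve 1 (λ a → :- (con 0ℚ :- a) := a :- con 0ℚ) refl (suc n · r)))
      (subst (_< r) (sym (QP.∣-p∣≡∣p∣ z)) small))

  infix 4 _≈_
  record _≈_ (x y : ℚ) : Set where
    constructor mod-r
    field
      difference : Multiple (x - y)

  ≈-reflexive : ∀ {x y} → x ≡ y → x ≈ y
  ≈-reflexive {x} {y} x≡y = mod-r (multiple 0 0 (trans (cong (_- y) x≡y) (QP.+-inverseʳ y)))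

  ≈-refl : ∀ {x} → x ≈ x
  ≈-refl = ≈-reflexive refl

  ≈-sym : ∀ {x y} → x ≈ y → y ≈ x
  ≈-sym {x} {y} (mod-r x-y) =
    mod-r (subst Multiple (solve 2 (λ x y → :- (x :- y) := y :- x) refl x y) (multiple-neg x-y))

  ≈-trans : ∀ {x y z} → x ≈ y → y ≈ z → x ≈ z
  ≈-trans {x} {y} {z} (mod-r x-y) (mod-r y-z) =
    mod-r (subst Multiple (solve 3 (λ x y z → (x :- y) :+ (y :- z) := x :- z) refl x y z) (multiple-+ x-y y-z))

  ≈-setoid : Setoid _ _
  ≈-setoid = record
    { Carrier       = ℚ
    ; _≈_           = _≈_
    ; isEquivalence = record { refl = ≈-refl ; sym = ≈-sym ; trans = ≈-trans }
    }

  module ≈-Reasoning = Relation.Binary.Reasoning.Setoid ≈-setoid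

  +-cong : ∀ {x y u v} → x ≈ y → u ≈ v → x + u ≈ y + v
  +-cong {x} {y} {u} {v} (mod-r x-y) (mod-r u-v) = mod-r (subst Multiple
    (solve 4 (λ x y u v → (x :- y) :+ (u :- v) := (x :+ u) :- (y :+ v)) refl x y u v) (multiple-+ x-y u-v))

  -‿cong : ∀ {x y} → x ≈ y → - x ≈ - y
  -‿cong {x} {y} (mod-r x-y) =
    mod-r (subst Multiple (solve 2 (λ x y → :- (x :- y) := (:- x) :- (:- y)) refl x y) (multiple-neg x-y))

  x+r≈x : ∀ x → x + r ≈ x
  x+r≈x x = mod-r (subst Multiple (solve 2 (λ x r → r := (x :+ r) :- x) refl x r) multiple-r)

  ≈∧small⇒≡ : ∀ {x y} → x ≈ y → ∣ x - y ∣ < r → x ≡ y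
  ≈∧small⇒≡ {x} {y} (mod-r x-y) small =
    trans (solve 2 (λ x y → x := (x :- y) :+ y) refl x y)
          (trans (cong (_+ y) (multiple-small⇒0 x-y small)) (QP.+-identityˡ y))

  h≉0 : ¬ h ≈ 0ℚ
  h≉0 h≈0 = QP.<-irrefl (sym (≈∧small⇒≡ h≈0 ∣h-0∣<r)) 0<h
    where
    ∣h-0∣<r : ∣ h - 0ℚ ∣ < r
    ∣h-0∣<r = subst₂ _<_ (sym (trans (cong ∣_∣ (QP.+-identityʳ h)) (QP.0≤p⇒∣p∣≡p (QP.<⇒≤ 0<h))))
                h+h≡r (p<p+q h 0<h)

  OnCircle : ℚ → Set
  OnCircle p = 0ℚ ≤ p × p < r

  ∣q-p∣<r : ∀ {p q} → OnCircle p → OnCircle q → ∣ q - p ∣ < r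
  ∣q-p∣<r {p} {q} (0≤p , p<r) (0≤q , q<r) = ∣-∣-elim (_< r)
    (subst (q - p <_) (solve 3 (λ p q r → (q :- p) :+ ((r :- q) :+ p) := r) refl p q r)
      (p<p+q (q - p) (QP.+-mono-<-≤ (p<q⇒0<q-p q<r) 0≤p)))
    (subst (- (q - p) <_) (solve 3 (λ p q r → (:- (q :- p)) :+ ((r :- p) :+ q) := r) refl p q r)
      (p<p+q (- (q - p)) (QP.+-mono-<-≤ (p<q⇒0<q-p p<r) 0≤q)))

  circDist≡ : ∀ p q → circDist r p q ≡ ∣ q - p ∣ ⊓ (r - ∣ q - p ∣)
  circDist≡ p q = cong (λ a → a ⊓ (r - a)) (∣p-q∣≡∣q-p∣ p q)

  record Arc (p q : ℚ) : Set where
    constructor arc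
    field
      length : ℚ
      short  : ∣ length ∣ ≤ d
      spans  : length ≈ q - p

  Arc-shift : ∀ {p q} c → Arc p q → Arc (p + c) (q + c)
  Arc-shift {p} {q} c (arc ℓ short spans) = arc ℓ short
    (≈-trans spans (≈-reflexive (solve 3 (λ p q c → q :- p := (q :+ c) :- (p :+ c)) refl p q c)))

  Arc-antipode : ∀ {p q} → Arc (p + h) q → Arc p (q + h)
  Arc-antipode {p} {q} (arc ℓ short spans) = arc ℓ short (begin
    ℓ                        ≈⟨ spans ⟩
    q - (p + h)              ≈⟨ x+r≈x (q - (p + h)) ⟨
    (q - (p + h)) + r        ≡⟨ cong (_+_ (q - (p + h))) h+h≡r ⟨
    (q - (p + h)) + (h + h)  ≡⟨ solve 3 (λ p q h → (q :- (p :+ h)) :+ (h :+ h) := (q :+ h) :- p) refl p q h ⟩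
    (q + h) - p              ∎)
    where open ≈-Reasoning

  complementary-arc : ∀ {p q} → ∣ q - p ∣ < r → r - ∣ q - p ∣ ≤ d → Arc p q
  complementary-arc {p} {q} ∣u∣<r s≤d = by-sign (QP.∣p∣≡p∨∣p∣≡-p u)
    where
    open ≈-Reasoning
    u s : ℚ
    u = q - p
    s = r - ∣ u ∣
    ∣s∣≤d : ∣ s ∣ ≤ d
    ∣s∣≤d = subst (_≤ d) (sym (QP.0≤p⇒∣p∣≡p (QP.<⇒≤ (p<q⇒0<q-p ∣u∣<r)))) s≤d
    by-sign : ∣ u ∣ ≡ u ⊎ ∣ u ∣ ≡ - u → Arc p q
    by-sign (inj₁ ∣u∣≡u)  = arc (- s) (subst (_≤ d) (sym (QP.∣-p∣≡∣p∣ s)) ∣s∣≤d) (begin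
      - s            ≈⟨ x+r≈x (- s) ⟨
      - s + r        ≡⟨ cong (λ a → - (r - a) + r) ∣u∣≡u ⟩
      - (r - u) + r  ≡⟨ solve 2 (λ r u → :- (r :- u) :+ r := u) refl r u ⟩
      u              ∎)
    by-sign (inj₂ ∣u∣≡-u) = arc s ∣s∣≤d (begin
      s              ≡⟨ cong (λ a → r - a) ∣u∣≡-u ⟩
      r - - u        ≡⟨ solve 2 (λ r u → r :- (:- u) := u :+ r) refl r u ⟩
      u + r          ≈⟨ x+r≈x u ⟩
      u              ∎)

  positive-arc : ∀ {p q} → OnCircle p → OnCircle q → circDist r p q ≤ d → Arc p q
  positive-arc {p} {q} p∈C q∈C close = by-min (QP.⊓-sel a (r - a))
    where
    a : ℚ
    a = ∣ q - p ∣
    close′ : a ⊓ (r - a) ≤ d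
    close′ = subst (_≤ d) (circDist≡ p q) close
    by-min : a ⊓ (r - a) ≡ a ⊎ a ⊓ (r - a) ≡ r - a → Arc p q
    by-min (inj₁ min≡a)   = arc (q - p) (subst (_≤ d) min≡a close′) ≈-refl
    by-min (inj₂ min≡r-a) = complementary-arc (∣q-p∣<r p∈C q∈C) (subst (_≤ d) min≡r-a close′)

  ∣a-h∣≤d : ∀ {a} → 1ℚ ≤ a → 1ℚ ≤ r - a → ∣ a - h ∣ ≤ d
  ∣a-h∣≤d {a} 1≤a 1≤r-a = ∣-∣-elim (_≤ d)
    (subst (a - h ≤_)
      (solve 2 (λ a r → (a :- r :* con ½) :+ ((r :- a) :- con 1ℚ) := r :* con ½ :- con 1ℚ) refl a r)
      (p≤p+q (a - h) (p≤q⇒0≤q-p 1≤r-a)))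
    (subst (- (a - h) ≤_)
      (solve 2 (λ a r → (:- (a :- r :* con ½)) :+ (a :- con 1ℚ) := r :* con ½ :- con 1ℚ) refl a r)
      (p≤p+q (- (a - h)) (p≤q⇒0≤q-p 1≤a)))

  negative-arc : ∀ {p q} → 1ℚ ≤ circDist r p q → Arc (p + h) q
  negative-arc {p} {q} far = by-sign (QP.∣p∣≡p∨∣p∣≡-p u)
    where
    open ≈-Reasoning
    u : ℚ
    u = q - p
    far′ : 1ℚ ≤ ∣ u ∣ ⊓ (r - ∣ u ∣)
    far′ = subst (1ℚ ≤_) (circDist≡ p q) far
    ∣s∣≤d : ∣ ∣ u ∣ - h ∣ ≤ d
    ∣s∣≤d = ∣a-h∣≤d (QP.≤-trans far′ (QP.p⊓q≤p ∣ u ∣ (r - ∣ u ∣)))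
                    (QP.≤-trans far′ (QP.p⊓q≤q ∣ u ∣ (r - ∣ u ∣)))
    by-sign : ∣ u ∣ ≡ u ⊎ ∣ u ∣ ≡ - u → Arc (p + h) q
    by-sign (inj₁ ∣u∣≡u)  = arc (∣ u ∣ - h) ∣s∣≤d (begin
      ∣ u ∣ - h    ≡⟨ cong (_- h) ∣u∣≡u ⟩
      u - h        ≡⟨ solve 3 (λ p q h → (q :- p) :- h := q :- (p :+ h)) refl p q h ⟩
      q - (p + h)  ∎)
    by-sign (inj₂ ∣u∣≡-u) = arc (- (∣ u ∣ - h)) (subst (_≤ d) (sym (QP.∣-p∣≡∣p∣ (∣ u ∣ - h))) ∣s∣≤d) (begin
      - (∣ u ∣ - h)            ≡⟨ cong (λ b → - (b - h)) ∣u∣≡-u ⟩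
      - (- u - h)              ≡⟨ solve 3 (λ p q h → :- (:- (q :- p) :- h) := (q :- (p :+ h)) :+ (h :+ h)) refl p q h ⟩
      (q - (p + h)) + (h + h)  ≡⟨ cong (_+_ (q - (p + h))) h+h≡r ⟩
      (q - (p + h)) + r        ≈⟨ x+r≈x (q - (p + h)) ⟩
      q - (p + h)              ∎)

  module Lifting (r<4 : r < four) {n : ℕ} {A : Set} (generator : A → Vec Bool n) (pos : Vec Bool n → ℚ)
                 (arc-along : ∀ σ a → Arc (pos σ) (pos (σ ⊖ generator a))) where

    4d<r : (d + d) + (d + d) < r
    4d<r = subst ((d + d) + (d + d) <_)
      (solve 1 (λ r → let d = r :* con ½ :- con 1ℚ in (d :+ d) :+ (d :+ d) :+ (con four :- r) := r) refl r)
      (p<p+q _ (p<q⇒0<q-p r<4))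

    ≈-short⇒≡ : ∀ {x y} → x ≈ y → ∣ x ∣ ≤ d + d → ∣ y ∣ ≤ d + d → x ≡ y
    ≈-short⇒≡ {x} {y} x≈y ∣x∣≤2d ∣y∣≤2d =
      ≈∧small⇒≡ x≈y
        (QP.≤-<-trans (QP.≤-trans (QP.∣p-q∣≤∣p∣+∣q∣ x y) (QP.+-mono-≤ ∣x∣≤2d ∣y∣≤2d)) 4d<r)

    step : A → Vec Bool n → Vec Bool n
    step a σ = σ ⊖ generator a

    step-comm : ∀ σ a b → step b (step a σ) ≡ step a (step b σ)
    step-comm σ a b = x⊖y⊖z≡x⊖z⊖y σ (generator a) (generator b)

    step-involutive : ∀ σ a → step a (step a σ) ≡ σ
    step-involutive σ a = x⊖y⊖y≡x σ (generator a)

    δ : Vec Bool n → A → ℚ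
    δ σ a = Arc.length (arc-along σ a)

    ∣δ∣≤d : ∀ σ a → ∣ δ σ a ∣ ≤ d
    ∣δ∣≤d σ a = Arc.short (arc-along σ a)

    ∣δ∣≤2d : ∀ σ a → ∣ δ σ a ∣ ≤ d + d
    ∣δ∣≤2d σ a = QP.≤-trans (∣δ∣≤d σ a) (p≤p+q d (QP.≤-trans (QP.0≤∣p∣ (δ σ a)) (∣δ∣≤d σ a)))

    ∣δ+δ∣≤2d : ∀ σ a τ b → ∣ δ σ a + δ τ b ∣ ≤ d + d
    ∣δ+δ∣≤2d σ a τ b =
      QP.≤-trans (QP.∣p+q∣≤∣p∣+∣q∣ (δ σ a) (δ τ b)) (QP.+-mono-≤ (∣δ∣≤d σ a) (∣δ∣≤d τ b))

    telescope : ∀ p q s {x y} → x ≈ q - p → y ≈ s - q → x + y ≈ s - p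
    telescope p q s {x} {y} x≈ y≈ = begin
      x + y              ≈⟨ +-cong x≈ y≈ ⟩
      (q - p) + (s - q)  ≡⟨ solve 3 (λ p q s → (q :- p) :+ (s :- q) := s :- p) refl p q s ⟩
      s - p              ∎
      where open ≈-Reasoning

    δ+δ≈ : ∀ σ a b → δ σ a + δ (step a σ) b ≈ pos (step b (step a σ)) - pos σ
    δ+δ≈ σ a b = telescope (pos σ) (pos (step a σ)) (pos (step b (step a σ)))
                   (Arc.spans (arc-along σ a)) (Arc.spans (arc-along (step a σ) b))

    δ-square : ∀ σ a b → δ σ a + δ (step a σ) b ≡ δ σ b + δ (step b σ) a
    δ-square σ a b = ≈-short⇒≡ (begin
      δ σ a + δ (step a σ) b           ≈⟨ δ+δ≈ σ a b ⟩
      pos (step b (step a σ)) - pos σ  ≡⟨ cong (λ τ → pos τ - pos σ) (step-comm σ a b) ⟩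
      pos (step a (step b σ)) - pos σ  ≈⟨ δ+δ≈ σ b a ⟨
      δ σ b + δ (step b σ) a           ∎)
      (∣δ+δ∣≤2d σ a (step a σ) b) (∣δ+δ∣≤2d σ b (step b σ) a)
      where open ≈-Reasoning

    δ-inverse : ∀ σ a → δ σ a + δ (step a σ) a ≡ 0ℚ
    δ-inverse σ a = ≈-short⇒≡ (begin
      δ σ a + δ (step a σ) a           ≈⟨ δ+δ≈ σ a a ⟩
      pos (step a (step a σ)) - pos σ  ≡⟨ cong (λ τ → pos τ - pos σ) (step-involutive σ a) ⟩
      pos σ - pos σ                    ≡⟨ QP.+-inverseʳ (pos σ) ⟩
      0ℚ                               ∎)
      (∣δ+δ∣≤2d σ a (step a σ) a) (QP.≤-trans (QP.0≤∣p∣ _) (∣δ+δ∣≤2d σ a (step a σ) a))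
      where open ≈-Reasoning

    winding : Vec Bool n → List A → ℚ
    winding σ []      = 0ℚ
    winding σ (a ∷ w) = δ σ a + winding (step a σ) w

    winding≈ : ∀ σ w → winding σ w ≈ pos (walk generator σ w) - pos σ
    winding≈ σ []      = ≈-reflexive (sym (QP.+-inverseʳ (pos σ)))
    winding≈ σ (a ∷ w) = telescope (pos σ) (pos (step a σ)) (pos (walk generator (step a σ) w))
                           (Arc.spans (arc-along σ a)) (winding≈ (step a σ) w)

    winding-++ : ∀ σ u v → winding σ (u ++ v) ≡ winding σ u + winding (walk generator σ u) v
    winding-++ σ []      v = sym (QP.+-identityˡ (winding σ v))
    winding-++ σ (a ∷ u) v = trans (cong (_+_ (δ σ a)) (winding-++ (step a σ) u v))
                                   (sym (QP.+-assoc (δ σ a) _ _))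

    winding-∷∷ : ∀ σ a b w → winding σ (a ∷ b ∷ w) ≡ (δ σ a + δ (step a σ) b) + winding (step b (step a σ)) w
    winding-∷∷ σ a b w = sym (QP.+-assoc (δ σ a) _ _)

    winding-swap : ∀ σ a b w → winding σ (a ∷ b ∷ w) ≡ winding σ (b ∷ a ∷ w)
    winding-swap σ a b w = begin
      winding σ (a ∷ b ∷ w)
        ≡⟨ winding-∷∷ σ a b w ⟩
      (δ σ a + δ (step a σ) b) + winding (step b (step a σ)) w
        ≡⟨ cong₂ _+_ (δ-square σ a b) (cong (λ τ → winding τ w) (step-comm σ a b)) ⟩
      (δ σ b + δ (step b σ) a) + winding (step a (step b σ)) w
        ≡⟨ winding-∷∷ σ b a w ⟨
      winding σ (b ∷ a ∷ w)
        ∎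
      where open ≡-Reasoning

    winding-cancel : ∀ σ a w → winding σ (a ∷ a ∷ w) ≡ winding σ w
    winding-cancel σ a w = begin
      winding σ (a ∷ a ∷ w)
        ≡⟨ winding-∷∷ σ a a w ⟩
      (δ σ a + δ (step a σ) a) + winding (step a (step a σ)) w
        ≡⟨ cong₂ _+_ (δ-inverse σ a) (cong (λ τ → winding τ w) (step-involutive σ a)) ⟩
      0ℚ + winding σ w
        ≡⟨ QP.+-identityˡ (winding σ w) ⟩
      winding σ w
        ∎
      where open ≡-Reasoning

    winding-move : ∀ σ a u v → winding σ (a ∷ u ++ v) ≡ winding σ (u ++ a ∷ v)
    winding-move σ a []      v = refl
    winding-move σ a (b ∷ u) v = trans (winding-swap σ a b (u ++ v))
                                       (cong (_+_ (δ σ b)) (winding-move (step b σ) a u v))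

    winding-double : ∀ σ w → winding σ (w ++ w) ≡ 0ℚ
    winding-double σ []      = refl
    winding-double σ (a ∷ w) = begin
      winding σ (a ∷ w ++ a ∷ w)                 ≡⟨ winding-move σ a w (a ∷ w) ⟩
      winding σ (w ++ a ∷ a ∷ w)                 ≡⟨ winding-++ σ w (a ∷ a ∷ w) ⟩
      winding σ w + winding σ′ (a ∷ a ∷ w)       ≡⟨ cong (_+_ (winding σ w)) (winding-cancel σ′ a w) ⟩
      winding σ w + winding σ′ w                 ≡⟨ winding-++ σ w w ⟨
      winding σ (w ++ w)                         ≡⟨ winding-double σ w ⟩
      0ℚ                                         ∎
      where
      open ≡-Reasoning
      σ′ = walk generator σ w

    module _ (w : List A) (antipodal : ∀ σ → pos (walk generator σ w) ≈ pos σ + h) where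

      antipode : Vec Bool n → Vec Bool n
      antipode σ = walk generator σ w

      step-antipode : ∀ a σ → step a (antipode σ) ≡ antipode (step a σ)
      step-antipode a σ = sym (walk-⊖ generator σ (generator a) w)

      δ-antipode : ∀ σ a → δ (antipode σ) a ≡ δ σ a
      δ-antipode σ a = ≈-short⇒≡ (begin
        δ (antipode σ) a
          ≈⟨ Arc.spans (arc-along (antipode σ) a) ⟩
        pos (step a (antipode σ)) - pos (antipode σ)
          ≡⟨ cong (λ τ → pos τ - pos (antipode σ)) (step-antipode a σ) ⟩
        pos (antipode (step a σ)) - pos (antipode σ)
          ≈⟨ +-cong (antipodal (step a σ)) (-‿cong (antipodal σ)) ⟩
        (pos (step a σ) + h) - (pos σ + h)
          ≡⟨ solve 3 (λ x y h → (y :+ h) :- (x :+ h) := y :- x) refl (pos σ) (pos (step a σ)) h ⟩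
        pos (step a σ) - pos σ
          ≈⟨ Arc.spans (arc-along σ a) ⟨
        δ σ a
          ∎)
        (∣δ∣≤2d (antipode σ) a) (∣δ∣≤2d σ a)
        where open ≈-Reasoning

      winding-antipode : ∀ σ v → winding (antipode σ) v ≡ winding σ v
      winding-antipode σ []      = refl
      winding-antipode σ (a ∷ v) = cong₂ _+_ (δ-antipode σ a)
        (trans (cong (λ τ → winding τ v) (step-antipode a σ)) (winding-antipode (step a σ) v))

      no-antipodal-walk : ⊥
      no-antipodal-walk = h≉0 h≈0
        where
        σ₀ : Vec Bool n
        σ₀ = replicate n false

        W : ℚ
        W = winding σ₀ w

        W≡0 : W ≡ 0ℚ
        W≡0 = trans (solve 1 (λ x → x := (x :+ x) :* con ½) refl W) (cong (_* ½) (begin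
          W + W                       ≡⟨ cong (_+_ W) (winding-antipode σ₀ w) ⟨
          W + winding (antipode σ₀) w ≡⟨ winding-++ σ₀ w w ⟨
          winding σ₀ (w ++ w)         ≡⟨ winding-double σ₀ w ⟩
          0ℚ                          ∎))
          where open ≡-Reasoning

        h≈0 : h ≈ 0ℚ
        h≈0 = begin
          h                           ≡⟨ solve 2 (λ x h → h := (x :+ h) :- x) refl (pos σ₀) h ⟩
          (pos σ₀ + h) - pos σ₀       ≈⟨ +-cong (antipodal σ₀) (≈-refl { - pos σ₀}) ⟨
          pos (antipode σ₀) - pos σ₀  ≈⟨ winding≈ σ₀ w ⟨
          W                           ≡⟨ W≡0 ⟩
          0ℚ                          ∎
          where open ≈-Reasoning

  -- The double cover of SPC(k) has vertices b ∷ x, where b = true marks the switched copy of x; switching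
  -- turns the negative edges of SPC(k) into the edges along allOnes (suc k).
  module DoubleCover {k : ℕ} {φ : Vec Bool k → ℚ} (colouring : IsCircularColoring (SPC k) r φ) where

    lift : Vec Bool (suc k) → ℚ
    lift (false ∷ x) = φ x
    lift (true  ∷ x) = φ x + h

    generator : Maybe (Fin k) → Vec Bool (suc k)
    generator (just i) = basis (suc i)
    generator nothing  = allOnes (suc k)

    arc-basis : ∀ x i → Arc (φ x) (φ (x ⊖ basis i))
    arc-basis x i = positive-arc (proj₁ colouring x) (proj₁ colouring (x ⊖ basis i))
                      (proj₂ (proj₂ colouring) x (x ⊖ basis i) (i , x⊖[x⊖y]≡y x (basis i)))

    arc-allOnes : ∀ x → Arc (φ x + h) (φ (x ⊖ allOnes k))
    arc-allOnes x =
      negative-arc {φ x} (proj₁ (proj₂ colouring) x (x ⊖ allOnes k) (x⊖[x⊖y]≡y x (allOnes k)))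

    lift-arc : ∀ σ a → Arc (lift σ) (lift (σ ⊖ generator a))
    lift-arc (false ∷ x) (just i) =
      subst (λ τ → Arc (φ x) (lift τ)) (sym (x⊖basis-suc false x i)) (arc-basis x i)
    lift-arc (true  ∷ x) (just i) =
      subst (λ τ → Arc (φ x + h) (lift τ)) (sym (x⊖basis-suc true x i)) (Arc-shift h (arc-basis x i))
    lift-arc (false ∷ x) nothing  = Arc-antipode (arc-allOnes x)
    lift-arc (true  ∷ x) nothing  = arc-allOnes x

    flip-sign : List (Maybe (Fin k))
    flip-sign = map just (allFin k) ∷ʳ nothing

    walk-flip-sign : ∀ b x → walk generator (b ∷ x) flip-sign ≡ (b xor true) ∷ x
    walk-flip-sign b x = begin
      walk generator (b ∷ x) (map just (allFin k) ∷ʳ nothing)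
        ≡⟨ foldl-∷ʳ _ (b ∷ x) nothing (map just (allFin k)) ⟩
      walk generator (b ∷ x) (map just (allFin k)) ⊖ allOnes (suc k)
        ≡⟨ cong (_⊖ allOnes (suc k)) (foldl-map _ just (b ∷ x) (allFin k)) ⟩
      walk (basis ∘ suc) (b ∷ x) (allFin k) ⊖ allOnes (suc k)
        ≡⟨ cong (_⊖ allOnes (suc k)) (walk-basis-suc b x (allFin k)) ⟩
      (b ∷ walk basis x (allFin k)) ⊖ allOnes (suc k)
        ≡⟨ cong (λ y → (b ∷ y) ⊖ allOnes (suc k)) (walk-allFin x) ⟩
      (b xor true) ∷ ((x ⊖ allOnes k) ⊖ allOnes k)
        ≡⟨ cong ((b xor true) ∷_) (x⊖y⊖y≡x x (allOnes k)) ⟩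
      (b xor true) ∷ x
        ∎
      where open ≡-Reasoning

    lift-antipodal : ∀ σ → lift (walk generator σ flip-sign) ≈ lift σ + h
    lift-antipodal (b ∷ x) =
      subst (λ τ → lift τ ≈ lift (b ∷ x) + h) (sym (walk-flip-sign b x)) (switch b)
      where
      switch : ∀ b → lift ((b xor true) ∷ x) ≈ lift (b ∷ x) + h
      switch false = ≈-refl
      switch true  = begin
        φ x            ≈⟨ x+r≈x (φ x) ⟨
        φ x + r        ≡⟨ cong (_+_ (φ x)) h+h≡r ⟨
        φ x + (h + h)  ≡⟨ QP.+-assoc (φ x) h h ⟨
        (φ x + h) + h  ∎
        where open ≈-Reasoning

no-colouring-below-four : ∀ k r → 0ℚ < r → r < four → ¬ CircularColorable (SPC k) r
no-colouring-below-four k r 0<r r<4 (φ , colouring) =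
  Lifting.no-antipodal-walk r<4 generator lift lift-arc flip-sign lift-antipodal
  where
  open Circle r 0<r
  open DoubleCover colouring

first-coordinate : ∀ {k} → Vec Bool (suc k) → ℚ
first-coordinate (false ∷ _) = 0ℚ
first-coordinate (true  ∷ _) = 1ℚ

first-coordinate-colouring : ∀ k → IsCircularColoring (SPC (suc k)) four first-coordinate
first-coordinate-colouring k = on-circle , negative , positive
  where
  on-circle : ∀ v → 0ℚ ≤ first-coordinate v × first-coordinate v < four
  on-circle (false ∷ _) = QP.≤ᵇ⇒≤ _ , from-yes (0ℚ <? four)
  on-circle (true  ∷ _) = QP.≤ᵇ⇒≤ _ , from-yes (1ℚ <? four)
  negative : ∀ u v → Neg (SPC (suc k)) u v →
             1ℚ ≤ circDist four (first-coordinate u) (first-coordinate v)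
  negative (false ∷ _) (true  ∷ _) _ = QP.≤ᵇ⇒≤ _
  negative (true  ∷ _) (false ∷ _) _ = QP.≤ᵇ⇒≤ _
  negative (false ∷ _) (false ∷ _) ()
  negative (true  ∷ _) (true  ∷ _) ()
  positive : ∀ u v → Pos (SPC (suc k)) u v →
             circDist four (first-coordinate u) (first-coordinate v) ≤ four * ½ - 1ℚ
  positive (false ∷ _) (false ∷ _) _ = QP.≤ᵇ⇒≤ _
  positive (false ∷ _) (true  ∷ _) _ = QP.≤ᵇ⇒≤ _
  positive (true  ∷ _) (false ∷ _) _ = QP.≤ᵇ⇒≤ _
  positive (true  ∷ _) (true  ∷ _) _ = QP.≤ᵇ⇒≤ _

mainTheorem7 : (k : ℕ) → k ≥ 1 → ChiCEquals (SPC k) (+ 4 / 1)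
mainTheorem7 (suc k) _ = (first-coordinate , first-coordinate-colouring k) , no-colouring-below-four (suc k)
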